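{- Let $\mathbf{Q}=\langle Q;\oplus,-,{}^+,{}^-,0,1\rangle$ be a strong quasi-MV* algebra. Define $x\to y:=-x\oplus y$ and $\neg x:=-x$ for $x,y\in Q$. Then $f(\mathbf{Q})=\langle Q;\to,\neg,{}^+,{}^-,1\rangle$ is a strong quasi-Wajsberg* algebra (with $x\vee y=((x^+\to y^+)^+\to(\neg x)^-)\to((y^-\to x^-)^-\to x^-)$).
   Context: A quasi-MV* algebra is an algebra $\langle A;\oplus,-,{}^+,{}^-,0,1\rangle$ of type $\langle 2,1,1,1,0,0\rangle$ such that for all $x,y,z$: (1) $x\oplus y=y\oplus x$; (2) $(1\oplus x)\oplus(y\oplus(1\oplus z))=((1\oplus x)\oplus y)\oplus(1\oplus z)$; (3) $(x\oplus1)\oplus1=1$; (4) $(x\oplus y)\oplus0=x\oplus y$; (5) $x^+\oplus0=(x\oplus0)^+=1\oplus(-1\oplus x)$ and $x^-\oplus0=(x\oplus0)^-=-1\oplus(1\oplus x)$; (6) $x\oplus y=(x^+\oplus y^+)\oplus(x^-\oplus y^-)$; (7) $0=-0$; (8) $x\oplus(-x)=0$; (9) $-(x\oplus y)=(-x)\oplus(-y)$; (10) $-(-x)=x$; (11) $(-x\oplus(x\oplus y))^+=-x^+\oplus(x^+\oplus y^+)$; (12)–(14) $\vee$ is commutative, associative, and $x\oplus(y\vee z)=(x\oplus y)\vee(x\oplus z)$; where $x\vee y:=(x^+\oplus(-x^+\oplus y^+)^+)\oplus(x^-\oplus(-x^-\oplus y^-)^+)$. It is strong if $x^+=x^+\oplus0$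 and $x^-=x^-\oplus0$ for all $x$. A quasi-Wajsberg* algebra is an algebra $\langle W;\to,\neg,{}^+,{}^-,1\rangle$ of type $\langle2,1,1,1,0\rangle$ such that for all $x,y,z$: (QW*1) $x\to y=\neg y\to\neg x$; (QW*2) $(x\to1)\to((y\to1)\to z)=(y\to1)\to((x\to1)\to z)$; (QW*3) $(1\to x)\to1=1$; (QW*4) $(z\to z)\to(x\to y)=x\to y$; (QW*5) $(1\to1)\to x^+=((1\to1)\to x)^+=(x\to1)\to1$ and $(1\to1)\to x^-=((1\to1)\to x)^-=(x\to\neg1)\to\neg1$; (QW*6) $x\to y=(y^+\to x^-)\to(x^+\to y^-)$; (QW*7) $\neg(x\to y)=y\to x$; (QW*8) $\neg\neg x=x$; (QW*9) $(x\to(\neg x\to y))^+=x^+\to(\neg x^+\to y^+)$; (QW*10)–(QW*12) $\vee$ is commutative, associative, and $x\to(y\vee z)=(x\to y)\vee(x\to z)$; where $x\vee y:=((x^+\to y^+)^+\to(\neg x)^-)\to((y^-\to x^-)^-\to x^-)$. It is strong if $x^+=(1\to1)\to x^+$ and $x^-=(1\to1)\to x^-$ for all $x$. -}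

module Defs where

open import Level using (Level)
open import Relation.Binary.PropositionalEquality using (_≡_)

record IsQuasiMVStar {a : Level} {A : Set a}
    (_⊕_ : A → A → A) (-_ : A → A) (_⁺ _⁻ : A → A) (𝟘 𝟙 : A) : Set a where
  _∨_ : A → A → A
  x ∨ y = ((x ⁺) ⊕ (((- (x ⁺)) ⊕ (y ⁺)) ⁺)) ⊕ ((x ⁻) ⊕ (((- (x ⁻)) ⊕ (y ⁻)) ⁺))
  field
    q1  : ∀ x y → x ⊕ y ≡ y ⊕ x
    q2  : ∀ x y z → (𝟙 ⊕ x) ⊕ (y ⊕ (𝟙 ⊕ z)) ≡ ((𝟙 ⊕ x) ⊕ y) ⊕ (𝟙 ⊕ z)
    q3  : ∀ x → (x ⊕ 𝟙) ⊕ 𝟙 ≡ 𝟙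
    q4  : ∀ x y → (x ⊕ y) ⊕ 𝟘 ≡ x ⊕ y
    q5a : ∀ x → (x ⁺) ⊕ 𝟘 ≡ (x ⊕ 𝟘) ⁺
    q5b : ∀ x → (x ⊕ 𝟘) ⁺ ≡ 𝟙 ⊕ ((- 𝟙) ⊕ x)
    q5c : ∀ x → (x ⁻) ⊕ 𝟘 ≡ (x ⊕ 𝟘) ⁻
    q5d : ∀ x → (x ⊕ 𝟘) ⁻ ≡ (- 𝟙) ⊕ (𝟙 ⊕ x)
    q6  : ∀ x y → x ⊕ y ≡ ((x ⁺) ⊕ (y ⁺)) ⊕ ((x ⁻) ⊕ (y ⁻))
    q7  : 𝟘 ≡ - 𝟘
    q8  : ∀ x → x ⊕ (- x) ≡ 𝟘
    q9  : ∀ x y → - (x ⊕ y) ≡ (- x) ⊕ (- y)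
    q10 : ∀ x → - (- x) ≡ x
    q11 : ∀ x y → ((- x) ⊕ (x ⊕ y)) ⁺ ≡ (- (x ⁺)) ⊕ ((x ⁺) ⊕ (y ⁺))
    q12 : ∀ x y → x ∨ y ≡ y ∨ x
    q13 : ∀ x y z → x ∨ (y ∨ z) ≡ (x ∨ y) ∨ z
    q14 : ∀ x y z → x ⊕ (y ∨ z) ≡ (x ⊕ y) ∨ (x ⊕ z)

record IsStrongQuasiMVStar {a : Level} {A : Set a}
    (_⊕_ : A → A → A) (-_ : A → A) (_⁺ _⁻ : A → A) (𝟘 𝟙 : A) : Set a where
  field
    isQuasiMVStar : IsQuasiMVStar _⊕_ -_ _⁺ _⁻ 𝟘 𝟙
    strong⁺ : ∀ x → x ⁺ ≡ (x ⁺) ⊕ 𝟘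
    strong⁻ : ∀ x → x ⁻ ≡ (x ⁻) ⊕ 𝟘

record IsQuasiWajsbergStar {a : Level} {W : Set a}
    (_⇒_ : W → W → W) (¬_ : W → W) (_⁺ _⁻ : W → W) (𝟙 : W) : Set a where
  _∨_ : W → W → W
  x ∨ y = ((((x ⁺) ⇒ (y ⁺)) ⁺) ⇒ ((¬ x) ⁻)) ⇒ ((((y ⁻) ⇒ (x ⁻)) ⁻) ⇒ (x ⁻))
  field
    w1  : ∀ x y → x ⇒ y ≡ (¬ y) ⇒ (¬ x)
    w2  : ∀ x y z → (x ⇒ 𝟙) ⇒ ((y ⇒ 𝟙) ⇒ z) ≡ (y ⇒ 𝟙) ⇒ ((x ⇒ 𝟙) ⇒ z)
    w3  : ∀ x → (𝟙 ⇒ x) ⇒ 𝟙 ≡ 𝟙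
    w4  : ∀ x y z → (z ⇒ z) ⇒ (x ⇒ y) ≡ x ⇒ y
    w5a : ∀ x → (𝟙 ⇒ 𝟙) ⇒ (x ⁺) ≡ ((𝟙 ⇒ 𝟙) ⇒ x) ⁺
    w5b : ∀ x → ((𝟙 ⇒ 𝟙) ⇒ x) ⁺ ≡ (x ⇒ 𝟙) ⇒ 𝟙
    w5c : ∀ x → (𝟙 ⇒ 𝟙) ⇒ (x ⁻) ≡ ((𝟙 ⇒ 𝟙) ⇒ x) ⁻
    w5d : ∀ x → ((𝟙 ⇒ 𝟙) ⇒ x) ⁻ ≡ (x ⇒ (¬ 𝟙)) ⇒ (¬ 𝟙)
    w6  : ∀ x y → x ⇒ y ≡ ((y ⁺) ⇒ (x ⁻)) ⇒ ((x ⁺) ⇒ (y ⁻))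
    w7  : ∀ x y → ¬ (x ⇒ y) ≡ y ⇒ x
    w8  : ∀ x → ¬ (¬ x) ≡ x
    w9  : ∀ x y → (x ⇒ ((¬ x) ⇒ y)) ⁺ ≡ (x ⁺) ⇒ ((¬ (x ⁺)) ⇒ (y ⁺))
    w10 : ∀ x y → x ∨ y ≡ y ∨ x
    w11 : ∀ x y z → x ∨ (y ∨ z) ≡ (x ∨ y) ∨ z
    w12 : ∀ x y z → x ⇒ (y ∨ z) ≡ (x ⇒ y) ∨ (x ⇒ z)

record IsStrongQuasiWajsbergStar {a : Level} {W : Set a}
    (_⇒_ : W → W → W) (¬_ : W → W) (_⁺ _⁻ : W → W) (𝟙 : W) : Set a where
  field
    isQuasiWajsbergStar : IsQuasiWajsbergStar _⇒_ ¬_ _⁺ _⁻ 𝟙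
    strong⁺ : ∀ x → x ⁺ ≡ (𝟙 ⇒ 𝟙) ⇒ (x ⁺)
    strong⁻ : ∀ x → x ⁻ ≡ (𝟙 ⇒ 𝟙) ⇒ (x ⁻)

fImp : {a : Level} {A : Set a} → (A → A → A) → (A → A) → A → A → A
fImp _⊕_ -_ x y = (- x) ⊕ y

module Submission where

-- Under x ⇒ y = -x ⊕ y every element z ⇒ z is 𝟘, so prefixing (z ⇒ z) ⇒ _ is adding 𝟘,
-- which turns (4), (5) and strongness into (QW*4), (QW*5) and strongness.  Strongness
-- makes x⁺ = 𝟙 ⊕ (-𝟙 ⊕ x) and x⁻ = -𝟙 ⊕ (𝟙 ⊕ x), hence -(x⁻) = (-x)⁺; with it (6)
-- becomes (QW*6), and the Wajsberg join becomes literally the MV join, so (QW*10–12)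
-- are (12–14).  (QW*2) is (2) after negating both sides.

open import Defs
open import Level using (Level)
open import Relation.Binary.PropositionalEquality using (_≡_; sym; trans; cong; cong₂; module ≡-Reasoning)
open ≡-Reasoning

module QuasiMVStarProperties {a : Level} {A : Set a}
    {_⊕_ : A → A → A} { -_ : A → A} {_⁺ _⁻ : A → A} {𝟘 𝟙 : A}
    (isQuasiMVStar : IsQuasiMVStar _⊕_ -_ _⁺ _⁻ 𝟘 𝟙) where
  open IsQuasiMVStar isQuasiMVStar

  _⇒_ : A → A → A
  _⇒_ = fImp _⊕_ -_

  -‿injective : ∀ {x y} → - x ≡ - y → x ≡ y
  -‿injective {x} {y} eq = trans (sym (q10 x)) (trans (cong -_ eq) (q10 y))

  ⊕-rotate : ∀ x y z → x ⊕ (y ⊕ z) ≡ (z ⊕ y) ⊕ x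
  ⊕-rotate x y z = trans (cong (x ⊕_) (q1 y z)) (q1 x (z ⊕ y))

  𝟙⊕-exchange : ∀ x y z → (𝟙 ⊕ x) ⊕ ((𝟙 ⊕ y) ⊕ z) ≡ (𝟙 ⊕ y) ⊕ ((𝟙 ⊕ x) ⊕ z)
  𝟙⊕-exchange x y z = begin
    (𝟙 ⊕ x) ⊕ ((𝟙 ⊕ y) ⊕ z) ≡⟨ cong ((𝟙 ⊕ x) ⊕_) (q1 _ _) ⟩
    (𝟙 ⊕ x) ⊕ (z ⊕ (𝟙 ⊕ y)) ≡⟨ q2 x z y ⟩
    ((𝟙 ⊕ x) ⊕ z) ⊕ (𝟙 ⊕ y) ≡⟨ q1 _ _ ⟩
    (𝟙 ⊕ y) ⊕ ((𝟙 ⊕ x) ⊕ z) ∎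

  -‿⇒ : ∀ x y → - (x ⇒ y) ≡ x ⊕ (- y)
  -‿⇒ x y = trans (q9 (- x) y) (cong (_⊕ (- y)) (q10 x))

  -‿⇒-swap : ∀ x y → - (x ⇒ y) ≡ y ⇒ x
  -‿⇒-swap x y = trans (-‿⇒ x y) (q1 x (- y))

  ⇒-contrapositive : ∀ x y → x ⇒ y ≡ (- y) ⇒ (- x)
  ⇒-contrapositive x y = trans (q1 (- x) y) (cong (_⊕ (- x)) (sym (q10 y)))

  ⇒-self : ∀ z → z ⇒ z ≡ 𝟘
  ⇒-self z = trans (q1 (- z) z) (q8 z)

  ⇒-selfˡ : ∀ z x → (z ⇒ z) ⇒ x ≡ x ⊕ 𝟘
  ⇒-selfˡ z x = begin
    (- (z ⇒ z)) ⊕ x ≡⟨ cong (λ u → (- u) ⊕ x) (⇒-self z) ⟩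
    (- 𝟘) ⊕ x       ≡⟨ cong (_⊕ x) (sym q7) ⟩
    𝟘 ⊕ x           ≡⟨ q1 𝟘 x ⟩
    x ⊕ 𝟘           ∎

  ⇒𝟙-exchange : ∀ x y z → (x ⇒ 𝟙) ⇒ ((y ⇒ 𝟙) ⇒ z) ≡ (y ⇒ 𝟙) ⇒ ((x ⇒ 𝟙) ⇒ z)
  ⇒𝟙-exchange x y z = -‿injective (begin
    - ((x ⇒ 𝟙) ⇒ ((y ⇒ 𝟙) ⇒ z))     ≡⟨ -‿⇒⇒ x y ⟩
    (𝟙 ⊕ (- x)) ⊕ ((𝟙 ⊕ (- y)) ⊕ (- z)) ≡⟨ 𝟙⊕-exchange (- x) (- y) (- z) ⟩
    (𝟙 ⊕ (- y)) ⊕ ((𝟙 ⊕ (- x)) ⊕ (- z)) ≡⟨ sym (-‿⇒⇒ y x) ⟩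
    - ((y ⇒ 𝟙) ⇒ ((x ⇒ 𝟙) ⇒ z))     ∎)
    where
    -‿⇒⇒ : ∀ u v → - ((u ⇒ 𝟙) ⇒ ((v ⇒ 𝟙) ⇒ z)) ≡ (𝟙 ⊕ (- u)) ⊕ ((𝟙 ⊕ (- v)) ⊕ (- z))
    -‿⇒⇒ u v = trans (-‿⇒ (u ⇒ 𝟙) _)
      (cong₂ _⊕_ (q1 (- u) 𝟙) (trans (-‿⇒ (v ⇒ 𝟙) z) (cong (_⊕ (- z)) (q1 (- v) 𝟙))))

  [𝟙⇒x]⇒𝟙≡𝟙 : ∀ x → (𝟙 ⇒ x) ⇒ 𝟙 ≡ 𝟙
  [𝟙⇒x]⇒𝟙≡𝟙 x = begin
    (- (𝟙 ⇒ x)) ⊕ 𝟙 ≡⟨ cong (_⊕ 𝟙) (trans (-‿⇒ 𝟙 x) (q1 𝟙 (- x))) ⟩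
    ((- x) ⊕ 𝟙) ⊕ 𝟙 ≡⟨ q3 (- x) ⟩
    𝟙               ∎

  ⇒-selfˡ-⇒ : ∀ x y z → (z ⇒ z) ⇒ (x ⇒ y) ≡ x ⇒ y
  ⇒-selfˡ-⇒ x y z = trans (⇒-selfˡ z (x ⇒ y)) (q4 (- x) y)

  ⇒-selfˡ-⁺ : ∀ z x → (z ⇒ z) ⇒ (x ⁺) ≡ ((z ⇒ z) ⇒ x) ⁺
  ⇒-selfˡ-⁺ z x = begin
    (z ⇒ z) ⇒ (x ⁺) ≡⟨ ⇒-selfˡ z (x ⁺) ⟩
    (x ⁺) ⊕ 𝟘       ≡⟨ q5a x ⟩
    (x ⊕ 𝟘) ⁺       ≡⟨ cong _⁺ (sym (⇒-selfˡ z x)) ⟩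
    ((z ⇒ z) ⇒ x) ⁺ ∎

  ⇒-selfˡ-⁻ : ∀ z x → (z ⇒ z) ⇒ (x ⁻) ≡ ((z ⇒ z) ⇒ x) ⁻
  ⇒-selfˡ-⁻ z x = begin
    (z ⇒ z) ⇒ (x ⁻) ≡⟨ ⇒-selfˡ z (x ⁻) ⟩
    (x ⁻) ⊕ 𝟘       ≡⟨ q5c x ⟩
    (x ⊕ 𝟘) ⁻       ≡⟨ cong _⁻ (sym (⇒-selfˡ z x)) ⟩
    ((z ⇒ z) ⇒ x) ⁻ ∎

  [[z⇒z]⇒x]⁺≡[x⇒𝟙]⇒𝟙 : ∀ z x → ((z ⇒ z) ⇒ x) ⁺ ≡ (x ⇒ 𝟙) ⇒ 𝟙
  [[z⇒z]⇒x]⁺≡[x⇒𝟙]⇒𝟙 z x = begin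
    ((z ⇒ z) ⇒ x) ⁺   ≡⟨ cong _⁺ (⇒-selfˡ z x) ⟩
    (x ⊕ 𝟘) ⁺         ≡⟨ q5b x ⟩
    𝟙 ⊕ ((- 𝟙) ⊕ x)   ≡⟨ ⊕-rotate 𝟙 (- 𝟙) x ⟩
    (x ⊕ (- 𝟙)) ⊕ 𝟙   ≡⟨ cong (_⊕ 𝟙) (sym (-‿⇒ x 𝟙)) ⟩
    (x ⇒ 𝟙) ⇒ 𝟙       ∎

  [[z⇒z]⇒x]⁻≡[x⇒-𝟙]⇒-𝟙 : ∀ z x → ((z ⇒ z) ⇒ x) ⁻ ≡ (x ⇒ (- 𝟙)) ⇒ (- 𝟙)
  [[z⇒z]⇒x]⁻≡[x⇒-𝟙]⇒-𝟙 z x = begin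
    ((z ⇒ z) ⇒ x) ⁻         ≡⟨ cong _⁻ (⇒-selfˡ z x) ⟩
    (x ⊕ 𝟘) ⁻               ≡⟨ q5d x ⟩
    (- 𝟙) ⊕ (𝟙 ⊕ x)         ≡⟨ ⊕-rotate (- 𝟙) 𝟙 x ⟩
    (x ⊕ 𝟙) ⊕ (- 𝟙)         ≡⟨ cong (λ u → (x ⊕ u) ⊕ (- 𝟙)) (sym (q10 𝟙)) ⟩
    (x ⊕ (- (- 𝟙))) ⊕ (- 𝟙) ≡⟨ cong (_⊕ (- 𝟙)) (sym (-‿⇒ x (- 𝟙))) ⟩
    (x ⇒ (- 𝟙)) ⇒ (- 𝟙)     ∎

  ⇒-⇒-neg : ∀ x y → x ⇒ ((- x) ⇒ y) ≡ (- x) ⊕ (x ⊕ y)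
  ⇒-⇒-neg x y = cong (λ u → (- x) ⊕ (u ⊕ y)) (q10 x)

  ⇒-⇒-neg-⁺ : ∀ x y → (x ⇒ ((- x) ⇒ y)) ⁺ ≡ (x ⁺) ⇒ ((- (x ⁺)) ⇒ (y ⁺))
  ⇒-⇒-neg-⁺ x y = begin
    (x ⇒ ((- x) ⇒ y)) ⁺              ≡⟨ cong _⁺ (⇒-⇒-neg x y) ⟩
    ((- x) ⊕ (x ⊕ y)) ⁺              ≡⟨ q11 x y ⟩
    (- (x ⁺)) ⊕ ((x ⁺) ⊕ (y ⁺))      ≡⟨ sym (⇒-⇒-neg (x ⁺) (y ⁺)) ⟩
    (x ⁺) ⇒ ((- (x ⁺)) ⇒ (y ⁺))      ∎

module StrongQuasiMVStarProperties {a : Level} {A : Set a}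
    {_⊕_ : A → A → A} { -_ : A → A} {_⁺ _⁻ : A → A} {𝟘 𝟙 : A}
    (isStrongQuasiMVStar : IsStrongQuasiMVStar _⊕_ -_ _⁺ _⁻ 𝟘 𝟙) where
  open IsStrongQuasiMVStar isStrongQuasiMVStar
  open IsQuasiMVStar isQuasiMVStar
  open QuasiMVStarProperties isQuasiMVStar

  ⁺-unfold : ∀ x → x ⁺ ≡ 𝟙 ⊕ ((- 𝟙) ⊕ x)
  ⁺-unfold x = trans (strong⁺ x) (trans (q5a x) (q5b x))

  ⁻-unfold : ∀ x → x ⁻ ≡ (- 𝟙) ⊕ (𝟙 ⊕ x)
  ⁻-unfold x = trans (strong⁻ x) (trans (q5c x) (q5d x))

  -‿⁻ : ∀ x → - (x ⁻) ≡ (- x) ⁺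
  -‿⁻ x = begin
    - (x ⁻)                   ≡⟨ cong -_ (⁻-unfold x) ⟩
    - ((- 𝟙) ⊕ (𝟙 ⊕ x))       ≡⟨ q9 (- 𝟙) (𝟙 ⊕ x) ⟩
    (- (- 𝟙)) ⊕ (- (𝟙 ⊕ x))   ≡⟨ cong₂ _⊕_ (q10 𝟙) (q9 𝟙 x) ⟩
    𝟙 ⊕ ((- 𝟙) ⊕ (- x))       ≡⟨ sym (⁺-unfold (- x)) ⟩
    (- x) ⁺                   ∎

  -‿⁺ : ∀ x → - (x ⁺) ≡ (- x) ⁻
  -‿⁺ x = -‿injective (begin
    - (- (x ⁺))   ≡⟨ q10 (x ⁺) ⟩
    x ⁺           ≡⟨ cong _⁺ (sym (q10 x)) ⟩
    (- (- x)) ⁺   ≡⟨ sym (-‿⁻ (- x)) ⟩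
    - ((- x) ⁻)   ∎)

  ⇒-split : ∀ x y → x ⇒ y ≡ ((y ⁺) ⇒ (x ⁻)) ⇒ ((x ⁺) ⇒ (y ⁻))
  ⇒-split x y = begin
    (- x) ⊕ y                                       ≡⟨ q6 (- x) y ⟩
    (((- x) ⁺) ⊕ (y ⁺)) ⊕ (((- x) ⁻) ⊕ (y ⁻))       ≡⟨ cong₂ (λ u v → u ⊕ (v ⊕ (y ⁻))) positive-part (sym (-‿⁺ x)) ⟩
    (- ((y ⁺) ⇒ (x ⁻))) ⊕ ((- (x ⁺)) ⊕ (y ⁻))       ∎
    where
    positive-part : ((- x) ⁺) ⊕ (y ⁺) ≡ - ((y ⁺) ⇒ (x ⁻))
    positive-part = trans (q1 _ _) (sym (trans (-‿⇒ (y ⁺) (x ⁻)) (cong ((y ⁺) ⊕_) (-‿⁻ x))))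

  _∨ʷ_ : A → A → A
  x ∨ʷ y = ((((x ⁺) ⇒ (y ⁺)) ⁺) ⇒ ((- x) ⁻)) ⇒ ((((y ⁻) ⇒ (x ⁻)) ⁻) ⇒ (x ⁻))

  ∨ʷ≡∨ : ∀ x y → x ∨ʷ y ≡ x ∨ y
  ∨ʷ≡∨ x y = cong₂ _⊕_ positive-part negative-part
    where
    positive-part : - ((((x ⁺) ⇒ (y ⁺)) ⁺) ⇒ ((- x) ⁻)) ≡ (x ⁺) ⊕ (((x ⁺) ⇒ (y ⁺)) ⁺)
    positive-part = begin
      - ((((x ⁺) ⇒ (y ⁺)) ⁺) ⇒ ((- x) ⁻))     ≡⟨ -‿⇒ _ ((- x) ⁻) ⟩
      (((x ⁺) ⇒ (y ⁺)) ⁺) ⊕ (- ((- x) ⁻))     ≡⟨ cong (((x ⁺) ⇒ (y ⁺)) ⁺ ⊕_) (trans (-‿⁻ (- x)) (cong _⁺ (q10 x))) ⟩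
      (((x ⁺) ⇒ (y ⁺)) ⁺) ⊕ (x ⁺)             ≡⟨ q1 _ (x ⁺) ⟩
      (x ⁺) ⊕ (((x ⁺) ⇒ (y ⁺)) ⁺)             ∎
    negative-part : (- (((y ⁻) ⇒ (x ⁻)) ⁻)) ⊕ (x ⁻) ≡ (x ⁻) ⊕ (((x ⁻) ⇒ (y ⁻)) ⁺)
    negative-part = begin
      (- (((y ⁻) ⇒ (x ⁻)) ⁻)) ⊕ (x ⁻)    ≡⟨ cong (_⊕ (x ⁻)) (-‿⁻ _) ⟩
      ((- ((y ⁻) ⇒ (x ⁻))) ⁺) ⊕ (x ⁻)    ≡⟨ cong (λ u → (u ⁺) ⊕ (x ⁻)) (-‿⇒-swap (y ⁻) (x ⁻)) ⟩
      (((x ⁻) ⇒ (y ⁻)) ⁺) ⊕ (x ⁻)        ≡⟨ q1 _ (x ⁻) ⟩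
      (x ⁻) ⊕ (((x ⁻) ⇒ (y ⁻)) ⁺)        ∎

  ∨ʷ-comm : ∀ x y → x ∨ʷ y ≡ y ∨ʷ x
  ∨ʷ-comm x y = trans (∨ʷ≡∨ x y) (trans (q12 x y) (sym (∨ʷ≡∨ y x)))

  ∨ʷ-assoc : ∀ x y z → x ∨ʷ (y ∨ʷ z) ≡ (x ∨ʷ y) ∨ʷ z
  ∨ʷ-assoc x y z = begin
    x ∨ʷ (y ∨ʷ z) ≡⟨ ∨ʷ≡∨ x _ ⟩
    x ∨ (y ∨ʷ z)  ≡⟨ cong (x ∨_) (∨ʷ≡∨ y z) ⟩
    x ∨ (y ∨ z)   ≡⟨ q13 x y z ⟩
    (x ∨ y) ∨ z   ≡⟨ cong (_∨ z) (sym (∨ʷ≡∨ x y)) ⟩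
    (x ∨ʷ y) ∨ z  ≡⟨ sym (∨ʷ≡∨ _ z) ⟩
    (x ∨ʷ y) ∨ʷ z ∎

  ⇒-distribˡ-∨ʷ : ∀ x y z → x ⇒ (y ∨ʷ z) ≡ (x ⇒ y) ∨ʷ (x ⇒ z)
  ⇒-distribˡ-∨ʷ x y z = begin
    (- x) ⊕ (y ∨ʷ z)            ≡⟨ cong ((- x) ⊕_) (∨ʷ≡∨ y z) ⟩
    (- x) ⊕ (y ∨ z)             ≡⟨ q14 (- x) y z ⟩
    ((- x) ⊕ y) ∨ ((- x) ⊕ z)   ≡⟨ sym (∨ʷ≡∨ _ _) ⟩
    (x ⇒ y) ∨ʷ (x ⇒ z)          ∎

  isStrongQuasiWajsbergStar : IsStrongQuasiWajsbergStar _⇒_ -_ _⁺ _⁻ 𝟙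
  isStrongQuasiWajsbergStar = record
    { isQuasiWajsbergStar = record
      { w1  = ⇒-contrapositive
      ; w2  = ⇒𝟙-exchange
      ; w3  = [𝟙⇒x]⇒𝟙≡𝟙
      ; w4  = ⇒-selfˡ-⇒
      ; w5a = ⇒-selfˡ-⁺ 𝟙
      ; w5b = [[z⇒z]⇒x]⁺≡[x⇒𝟙]⇒𝟙 𝟙
      ; w5c = ⇒-selfˡ-⁻ 𝟙
      ; w5d = [[z⇒z]⇒x]⁻≡[x⇒-𝟙]⇒-𝟙 𝟙
      ; w6  = ⇒-split
      ; w7  = -‿⇒-swap
      ; w8  = q10
      ; w9  = ⇒-⇒-neg-⁺
      ; w10 = ∨ʷ-comm
      ; w11 = ∨ʷ-assoc
      ; w12 = ⇒-distribˡ-∨ʷ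
      }
    ; strong⁺ = λ x → trans (strong⁺ x) (sym (⇒-selfˡ 𝟙 (x ⁺)))
    ; strong⁻ = λ x → trans (strong⁻ x) (sym (⇒-selfˡ 𝟙 (x ⁻)))
    }

proposition3p4 : {a : Level} {Q : Set a}
    (_⊕_ : Q → Q → Q) (-_ : Q → Q) (_⁺ _⁻ : Q → Q) (𝟘 𝟙 : Q) →
    IsStrongQuasiMVStar _⊕_ -_ _⁺ _⁻ 𝟘 𝟙 →
    IsStrongQuasiWajsbergStar (fImp _⊕_ -_) -_ _⁺ _⁻ 𝟙
proposition3p4 _ _ _ _ _ _ = StrongQuasiMVStarProperties.isStrongQuasiWajsbergStar
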